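{- Let $I=(V,d,s)$ be a $(v_L,v_R)$-spanned instance of Channel Assignment and let $l,r\in\mathbb{N}$. Then, for two new vertices $w_L,w_R\notin V$, there is a $(w_L,w_R)$-spanned instance $I'=(V\cup\{w_L,w_R\},d',l+s+r)$ of Channel Assignment such that: (i) for every YES-coloring $c$ of $I$ there is a YES-coloring $c'$ of $I'$ with $c'|_V=c$; (ii) for every YES-coloring $c'$ of $I'$ with $c'(w_L)\le c'(w_R)$, the restriction $c'|_V$ is a YES-coloring of $I$, and $c'(v_L)=c'(w_L)+l$ and $c'(v_R)=c'(w_R)-r$.
   Context: An instance of Channel Assignment is a triple $(V,d,s)$ where $V$ is a finite set, $d:V\times V\to\mathbb{N}$ is symmetric ($\mathbb{N}\ni 0$) and $s\in\mathbb{N}$. A coloring $c:V\to\mathbb{Z}$ is proper if $|c(x)-c(y)|\ge d(x,y)$ for all distinct $x,y\in V$; its span is $\max_{v}c(v)-\min_v c(v)+1$. A YES-coloring is a proper coloring of span at most $s$. The instance is $(x,y)$-spanned for $x,y\in V$ if every YES-coloring $c$ satisfies $|c(x)-c(y)|=s-1$. -}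

module Defs where

open import Data.Nat using (ℕ) renaming (_≤_ to _≤ℕ_)
open import Data.Product using (_×_)
open import Data.Integer using (ℤ; +_; _-_; _+_; _≤_; ∣_∣)
open import Relation.Binary.PropositionalEquality using (_≡_; _≢_)

record Instance (V : Set) : Set where
  field
    d    : V → V → ℕ
    dsym : ∀ x y → d x y ≡ d y x
    s    : ℕ
open Instance public

Coloring : Set → Set
Coloring V = V → ℤ

Proper : ∀ {V} → Instance V → Coloring V → Set
Proper I c = ∀ x y → x ≢ y → d I x y ≤ℕ ∣ c x - c y ∣

-- span(c) ≤ s, i.e. max c - min c + 1 ≤ s, written out pairwise:
-- for all x, y : c(x) - c(y) + 1 ≤ s
SpanAtMost : ∀ {V} → Coloring V → ℕ → Set
SpanAtMost c s = ∀ x y → (c x - c y) + + 1 ≤ + s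

YES : ∀ {V} → Instance V → Coloring V → Set
YES I c = Proper I c × SpanAtMost c (s I)

Spanned : ∀ {V} → Instance V → V → V → Set
Spanned I x y = ∀ c → YES I c → + ∣ c x - c y ∣ ≡ + (s I) - + 1

data Ext (V : Set) : Set where
  old : V → Ext V
  wL  : Ext V
  wR  : Ext V

-- Join wL to every old vertex at distance l and wR at distance r, except that the
-- distances wL–vR and vL–wR get an extra s - 1, and put wL, wR at distance
-- l + s - 1 + r, the largest one a span of l + s + r allows.  Then (wL, wR) spans
-- the new instance and every old colour lies between c'(wL) and c'(wR); the
-- distances l and r squeeze the old colours into a window of span s, so vL and vR,
-- whose colours differ by s - 1, sit at its two ends, and the extra s - 1 rules
-- out the end with vL next to wR.  Conversely, putting wL at l below c(vL) and wR
-- at r above c(vR) extends a YES-colouring with c(vL) ≤ c(vR); the other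
-- orientation follows by negating the colouring.
module Submission where

open import Defs
open import Data.Nat using (ℕ) renaming (_+_ to _+ℕ_)
open import Data.Fin using (Fin)
open import Data.Integer using (ℤ; +_; _-_; _+_; _≤_)
open import Data.Product using (Σ; _×_)
open import Function using (_∘_)
open import Relation.Binary.PropositionalEquality using (_≡_)

open import Data.Bool using (true; false; if_then_else_)
open import Data.Fin.Properties using () renaming (_≟_ to _≟ᶠ_)
open import Data.Integer using (-_; ∣_∣; +≤+)
open import Data.Integer.Properties
open import Data.Integer.Tactic.RingSolver using (solve; solve-∀)
open import Data.List using (_∷_; [])
import Data.Nat as ℕ
import Data.Nat.Properties as ℕ
open import Data.Product using (_,_; proj₁; proj₂)
open import Data.Sum using ([_,_]′; inj₁; inj₂)
open import Relation.Binary.Definitions using (DecidableEquality)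
open import Relation.Binary.PropositionalEquality using (refl; sym; trans; cong; cong₂; subst; _≢_; module ≡-Reasoning)
open import Relation.Nullary using (yes; no; does; contradiction)
open import Relation.Nullary.Decidable using (dec-true)

k≤∣i-j∣⇒i+k≤j : ∀ {i j k} → i ≤ j → k ℕ.≤ ∣ i - j ∣ → i + + k ≤ j
k≤∣i-j∣⇒i+k≤j {i} {j} {k} i≤j k≤∣i-j∣ = begin
  i + + k          ≤⟨ +-monoʳ-≤ i (+≤+ k≤∣i-j∣) ⟩
  i + + ∣ i - j ∣  ≡⟨ cong (λ t → i + t) (∣-∣-≤ i≤j) ⟩
  i + (j - i)      ≡⟨ solve (i ∷ j ∷ []) ⟩
  j                ∎
  where open ≤-Reasoning

i+k≤j⇒k≤j-i : ∀ i {j k} → i + k ≤ j → k ≤ j - i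
i+k≤j⇒k≤j-i i {j} {k} i+k≤j = begin
  k          ≡⟨ solve (i ∷ k ∷ []) ⟩
  i + k - i  ≤⟨ +-monoˡ-≤ (- i) i+k≤j ⟩
  j - i      ∎
  where open ≤-Reasoning

i+k≤j⇒k≤∣i-j∣ : ∀ i {j k} → i + + k ≤ j → k ℕ.≤ ∣ i - j ∣
i+k≤j⇒k≤∣i-j∣ i {j} {k} i+k≤j =
  drop‿+≤+ (subst (+ k ≤_) (sym (∣-∣-≤ (≤-trans (i≤i+j i (+ k)) i+k≤j))) (i+k≤j⇒k≤j-i i i+k≤j))

i+k≤j⇒k≤∣j-i∣ : ∀ i {j k} → i + + k ≤ j → k ℕ.≤ ∣ j - i ∣
i+k≤j⇒k≤∣j-i∣ i {j} {k} i+k≤j = subst (k ℕ.≤_) (∣i-j∣≡∣j-i∣ i j) (i+k≤j⇒k≤∣i-j∣ i i+k≤j)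

i+k≤j⇒i≤j-k : ∀ i {j k} → i + k ≤ j → i ≤ j - k
i+k≤j⇒i≤j-k i {j} {k} i+k≤j = begin
  i          ≡⟨ solve (i ∷ k ∷ []) ⟩
  i + k - k  ≤⟨ +-monoˡ-≤ (- k) i+k≤j ⟩
  j - k      ∎
  where open ≤-Reasoning

i-k+1≤1+[i-j]⇒j≤k : ∀ {i j k} → i - k + + 1 ≤ + 1 + (i - j) → j ≤ k
i-k+1≤1+[i-j]⇒j≤k {i} {j} {k} h = begin
  j                        ≡⟨ solve (i ∷ j ∷ []) ⟩
  i - (+ 1 + (i - j)) + + 1  ≤⟨ +-monoˡ-≤ (+ 1) (+-monoʳ-≤ i (neg-mono-≤ h)) ⟩
  i - (i - k + + 1) + + 1    ≡⟨ solve (i ∷ k ∷ []) ⟩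
  k                        ∎
  where open ≤-Reasoning

k-j+1≤1+[i-j]⇒k≤i : ∀ {i j k} → k - j + + 1 ≤ + 1 + (i - j) → k ≤ i
k-j+1≤1+[i-j]⇒k≤i {i} {j} {k} h = begin
  k                          ≡⟨ solve (j ∷ k ∷ []) ⟩
  k - j + + 1 + (j - + 1)        ≤⟨ +-monoˡ-≤ (j - + 1) h ⟩
  + 1 + (i - j) + (j - + 1)      ≡⟨ solve (i ∷ j ∷ []) ⟩
  i                          ∎
  where open ≤-Reasoning

1+k≡1+[j-i]⇒j≡i+k : ∀ {i j k} → + 1 + k ≡ + 1 + (j - i) → j ≡ i + k
1+k≡1+[j-i]⇒j≡i+k {i} {j} {k} h = begin
  j                        ≡⟨ solve (i ∷ j ∷ []) ⟩
  i + (+ 1 + (j - i) - + 1)  ≡⟨ cong (λ t → i + (t - + 1)) h ⟨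
  i + (+ 1 + k - + 1)        ≡⟨ solve (i ∷ k ∷ []) ⟩
  i + k                    ∎
  where open ≡-Reasoning

YES-neg : ∀ {V} (I : Instance V) (c : Coloring V) → YES I c → YES I (-_ ∘ c)
YES-neg I c (proper , span) = proper⁻ , span⁻
  where
  proper⁻ : Proper I (-_ ∘ c)
  proper⁻ x y x≢y = subst (d I x y ℕ.≤_) (sym (∣-i+j∣≡∣i-j∣ (c x) (c y))) (proper x y x≢y)
    where
    ∣-i+j∣≡∣i-j∣ : ∀ i j → ∣ - i - - j ∣ ≡ ∣ i - j ∣
    ∣-i+j∣≡∣i-j∣ i j = trans (cong ∣_∣ (sym (neg-distrib-+ i (- j)))) (∣-i∣≡∣i∣ (i - j))
  span⁻ : SpanAtMost (-_ ∘ c) (s I)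
  span⁻ x y = subst (_≤ + s I) (swap (c x) (c y)) (span y x)
    where
    swap : ∀ i j → j - i + + 1 ≡ - i - - j + + 1
    swap = solve-∀

SpanAtMost⇒∣-∣< : ∀ {V} (c : Coloring V) {s} → SpanAtMost c s → ∀ x y → ∣ c x - c y ∣ ℕ.< s
SpanAtMost⇒∣-∣< c {s} span x y =
  [ ordered x y , (λ cy≤cx → subst (ℕ._< s) (∣i-j∣≡∣j-i∣ (c y) (c x)) (ordered y x cy≤cx)) ]′
    (≤-total (c x) (c y))
  where
  ordered : ∀ x y → c x ≤ c y → ∣ c x - c y ∣ ℕ.< s
  ordered x y cx≤cy = drop‿+≤+ (begin
    + 1 + + ∣ c x - c y ∣  ≡⟨ cong (λ t → + 1 + t) (∣-∣-≤ cx≤cy) ⟩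
    + 1 + (c y - c x)       ≡⟨ +-comm (+ 1) (c y - c x) ⟩
    c y - c x + + 1         ≤⟨ span y x ⟩
    + s                     ∎)
    where open ≤-Reasoning

far⇒spanned : ∀ {V} (I : Instance V) {x y} → x ≢ y → s I ℕ.≤ ℕ.suc (d I x y) → Spanned I x y
far⇒spanned I {x} {y} x≢y s≤1+d c (proper , span) =
  cong (λ t → + t - + 1) (sym s≡1+∣cx-cy∣)
  where
  s≡1+∣cx-cy∣ : s I ≡ ℕ.suc ∣ c x - c y ∣
  s≡1+∣cx-cy∣ = ℕ.≤-antisym (ℕ.≤-trans s≤1+d (ℕ.s≤s (proper x y x≢y)))
                             (SpanAtMost⇒∣-∣< c span x y)

spanned⇒s≡1+∣-∣ : ∀ {V} (I : Instance V) {x y} → Spanned I x y → ∀ c → YES I c →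
                  s I ≡ ℕ.suc ∣ c x - c y ∣
spanned⇒s≡1+∣-∣ I {x} {y} spanned c c-YES = +-injective (begin
  + s I                  ≡⟨ i≡1+[i-1] (+ s I) ⟩
  + 1 + (+ s I - + 1)    ≡⟨ cong (λ t → + 1 + t) (spanned c c-YES) ⟨
  + 1 + + ∣ c x - c y ∣  ∎)
  where
  open ≡-Reasoning
  i≡1+[i-1] : ∀ i → i ≡ + 1 + (i - + 1)
  i≡1+[i-1] = solve-∀

spanned⇒+s≡1+[y-x] : ∀ {V} (I : Instance V) {x y} → Spanned I x y → ∀ c → YES I c → c x ≤ c y →
                     + s I ≡ + 1 + (c y - c x)
spanned⇒+s≡1+[y-x] I spanned c c-YES cx≤cy =
  trans (cong +_ (spanned⇒s≡1+∣-∣ I spanned c c-YES)) (cong (λ t → + 1 + t) (∣-∣-≤ cx≤cy))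

spanned⇒window : ∀ {V} (I : Instance V) {x y} → Spanned I x y → ∀ c → YES I c → c x ≤ c y →
                 ∀ v → c x ≤ c v × c v ≤ c y
spanned⇒window I {x} {y} spanned c c-YES@(_ , span) cx≤cy v =
  i-k+1≤1+[i-j]⇒j≤k {c y} (subst (c y - c v + + 1 ≤_) +s≡1+[y-x] (span y v)) ,
  k-j+1≤1+[i-j]⇒k≤i (subst (c v - c x + + 1 ≤_) +s≡1+[y-x] (span v x))
  where
  +s≡1+[y-x] : + s I ≡ + 1 + (c y - c x)
  +s≡1+[y-x] = spanned⇒+s≡1+[y-x] I spanned c c-YES cx≤cy

bounded⇒SpanAtMost : ∀ {V} {c : Coloring V} {lo hi s} →
  (∀ v → lo ≤ c v) → (∀ v → c v ≤ hi) → hi - lo + + 1 ≤ + s → SpanAtMost c s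
bounded⇒SpanAtMost lo≤c c≤hi hi-lo<s x y =
  ≤-trans (+-monoˡ-≤ (+ 1) (+-mono-≤ (c≤hi x) (neg-mono-≤ (lo≤c y)))) hi-lo<s

old-injective : ∀ {V} {x y : V} → old x ≡ old y → x ≡ y
old-injective refl = refl

module Extension {V : Set} (_≟_ : DecidableEquality V) (I : Instance V) (vL vR : V) (l r : ℕ) where

  w : ℕ
  w = ℕ.pred (s I)

  dL dR : V → ℕ
  dL v = if does (v ≟ vR) then l +ℕ w else l
  dR v = if does (v ≟ vL) then r +ℕ w else r

  d' : Ext V → Ext V → ℕ
  d' (old x) (old y) = d I x y
  d' (old x) wL      = dL x
  d' (old x) wR      = dR x
  d' wL      (old y) = dL y
  d' wR      (old y) = dR y
  d' wL      wR      = l +ℕ w +ℕ r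
  d' wR      wL      = l +ℕ w +ℕ r
  d' _       _       = 0

  d'-sym : ∀ x y → d' x y ≡ d' y x
  d'-sym (old x) (old y) = dsym I x y
  d'-sym (old _) wL      = refl
  d'-sym (old _) wR      = refl
  d'-sym wL      (old _) = refl
  d'-sym wL      wL      = refl
  d'-sym wL      wR      = refl
  d'-sym wR      (old _) = refl
  d'-sym wR      wL      = refl
  d'-sym wR      wR      = refl

  I' : Instance (Ext V)
  I' = record { d = d' ; dsym = d'-sym ; s = l +ℕ s I +ℕ r }

  I'-spanned : Spanned I' wL wR
  I'-spanned = far⇒spanned I' (λ ()) L≤1+K
    where
    n≤1+pred[n] : ∀ n → n ℕ.≤ ℕ.suc (ℕ.pred n)
    n≤1+pred[n] ℕ.zero    = ℕ.z≤n
    n≤1+pred[n] (ℕ.suc n) = ℕ.≤-refl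
    L≤1+K : l +ℕ s I +ℕ r ℕ.≤ ℕ.suc (l +ℕ w +ℕ r)
    L≤1+K = subst (l +ℕ s I +ℕ r ℕ.≤_) (cong (_+ℕ r) (ℕ.+-suc l w))
              (ℕ.+-monoˡ-≤ r (ℕ.+-monoʳ-≤ l (n≤1+pred[n] (s I))))

  l≤dL : ∀ v → l ℕ.≤ dL v
  l≤dL v with does (v ≟ vR)
  ... | true  = ℕ.m≤m+n l w
  ... | false = ℕ.≤-refl

  r≤dR : ∀ v → r ℕ.≤ dR v
  r≤dR v with does (v ≟ vL)
  ... | true  = ℕ.m≤m+n r w
  ... | false = ℕ.≤-refl

  dL-vR : dL vR ≡ l +ℕ w
  dL-vR = cong (λ b → if b then l +ℕ w else l) (dec-true (vR ≟ vR) refl)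

  dR-vL : dR vL ≡ r +ℕ w
  dR-vL = cong (λ b → if b then r +ℕ w else r) (dec-true (vL ≟ vL) refl)

  1+w≡s : Spanned I vL vR → ∀ c → YES I c → ℕ.suc w ≡ s I
  1+w≡s spanned c c-YES = sym (trans s≡1+∣-∣ (cong (ℕ.suc ∘ ℕ.pred) (sym s≡1+∣-∣)))
    where
    s≡1+∣-∣ : s I ≡ ℕ.suc ∣ c vL - c vR ∣
    s≡1+∣-∣ = spanned⇒s≡1+∣-∣ I spanned c c-YES

  extend : Coloring V → Coloring (Ext V)
  extend c (old v) = c v
  extend c wL      = c vL - + l
  extend c wR      = c vR + + r

  module _ (spanned : Spanned I vL vR) (c : Coloring V) (c-YES : YES I c)
           (cvL≤cvR : c vL ≤ c vR) where

    +1+w≡+s : + ℕ.suc w ≡ + s I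
    +1+w≡+s = cong +_ (1+w≡s spanned c c-YES)

    cvR≡cvL+w : c vR ≡ c vL + + w
    cvR≡cvL+w = 1+k≡1+[j-i]⇒j≡i+k (trans +1+w≡+s (spanned⇒+s≡1+[y-x] I spanned c c-YES cvL≤cvR))

    window : ∀ v → c vL ≤ c v × c v ≤ c vR
    window = spanned⇒window I spanned c c-YES cvL≤cvR

    wL-below : ∀ v → extend c wL + + dL v ≤ c v
    wL-below v with v ≟ vR
    ... | yes refl = ≤-reflexive (trans (i-j+[j+k]≡i+k (c vL) (+ l) (+ w)) (sym cvR≡cvL+w))
      where
      i-j+[j+k]≡i+k : ∀ i j k → i - j + (j + k) ≡ i + k
      i-j+[j+k]≡i+k = solve-∀
    ... | no _ = ≤-trans (≤-reflexive (i-j+j≡i (c vL) (+ l))) (proj₁ (window v))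
      where
      i-j+j≡i : ∀ i j → i - j + j ≡ i
      i-j+j≡i = solve-∀

    wR-above : ∀ v → c v + + dR v ≤ extend c wR
    wR-above v with v ≟ vL
    ... | yes refl = ≤-reflexive (trans (i+[j+k]≡i+k+j (c vL) (+ r) (+ w)) (cong (_+ + r) (sym cvR≡cvL+w)))
      where
      i+[j+k]≡i+k+j : ∀ i j k → i + (j + k) ≡ i + k + j
      i+[j+k]≡i+k+j = solve-∀
    ... | no _ = +-monoˡ-≤ (+ r) (proj₂ (window v))

    wL-below-wR : extend c wL + + (l +ℕ w +ℕ r) ≤ extend c wR
    wL-below-wR = ≤-reflexive (trans (i-j+[j+k+m]≡i+k+m (c vL) (+ l) (+ w) (+ r))
                                     (cong (_+ + r) (sym cvR≡cvL+w)))
      where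
      i-j+[j+k+m]≡i+k+m : ∀ i j k m → i - j + (j + k + m) ≡ i + k + m
      i-j+[j+k+m]≡i+k+m = solve-∀

    extend-proper : Proper I' (extend c)
    extend-proper (old x) (old y) x≢y = proj₁ c-YES x y (x≢y ∘ cong old)
    extend-proper (old v) wL      _   = i+k≤j⇒k≤∣j-i∣ (extend c wL) (wL-below v)
    extend-proper (old v) wR      _   = i+k≤j⇒k≤∣i-j∣ (c v) (wR-above v)
    extend-proper wL      (old v) _   = i+k≤j⇒k≤∣i-j∣ (extend c wL) (wL-below v)
    extend-proper wR      (old v) _   = i+k≤j⇒k≤∣j-i∣ (c v) (wR-above v)
    extend-proper wL      wR      _   = i+k≤j⇒k≤∣i-j∣ (extend c wL) wL-below-wR
    extend-proper wR      wL      _   = i+k≤j⇒k≤∣j-i∣ (extend c wL) wL-below-wR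
    extend-proper wL      wL      x≢x = contradiction refl x≢x
    extend-proper wR      wR      x≢x = contradiction refl x≢x

    wL≤wR : extend c wL ≤ extend c wR
    wL≤wR = ≤-trans (i≤i+j (extend c wL) (+ (l +ℕ w +ℕ r))) wL-below-wR

    wL≤ : ∀ x → extend c wL ≤ extend c x
    wL≤ (old v) = ≤-trans (i-j≤i (c vL) (+ l)) (proj₁ (window v))
    wL≤ wL      = ≤-refl
    wL≤ wR      = wL≤wR

    ≤wR : ∀ x → extend c x ≤ extend c wR
    ≤wR (old v) = ≤-trans (proj₂ (window v)) (i≤i+j (c vR) (+ r))
    ≤wR wL      = wL≤wR
    ≤wR wR      = ≤-refl

    extend-span≡ : extend c wR - extend c wL + + 1 ≡ + (l +ℕ s I +ℕ r)
    extend-span≡ = begin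
      c vR + + r - (c vL - + l) + + 1        ≡⟨ cong (λ t → t + + r - (c vL - + l) + + 1) cvR≡cvL+w ⟩
      c vL + + w + + r - (c vL - + l) + + 1  ≡⟨ width (c vL) (+ l) (+ w) (+ r) ⟩
      + l + (+ 1 + + w) + + r                ≡⟨ cong (λ t → + l + t + + r) +1+w≡+s ⟩
      + l + + s I + + r                      ∎
      where
      open ≡-Reasoning
      width : ∀ i j k m → i + k + m - (i - j) + + 1 ≡ j + (+ 1 + k) + m
      width = solve-∀

    extend-YES : YES I' (extend c)
    extend-YES = extend-proper , bounded⇒SpanAtMost wL≤ ≤wR (≤-reflexive extend-span≡)

  extension : Spanned I vL vR → ∀ c → YES I c →
              Σ (Coloring (Ext V)) λ c' → YES I' c' × (∀ v → c' (old v) ≡ c v)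
  extension spanned c c-YES with ≤-total (c vL) (c vR)
  ... | inj₁ cvL≤cvR = extend c , extend-YES spanned c c-YES cvL≤cvR , λ _ → refl
  ... | inj₂ cvR≤cvL =
    -_ ∘ extend (-_ ∘ c) ,
    YES-neg I' (extend (-_ ∘ c)) (extend-YES spanned (-_ ∘ c) (YES-neg I c c-YES) (neg-mono-≤ cvR≤cvL)) ,
    λ v → neg-involutive (c v)

  module _ (spanned : Spanned I vL vR) (c' : Coloring (Ext V)) (c'-YES : YES I' c')
           (a≤b : c' wL ≤ c' wR) where

    private
      a b : ℤ
      a = c' wL
      b = c' wR

    +L≡1+b-a : + (l +ℕ s I +ℕ r) ≡ + 1 + (b - a)
    +L≡1+b-a = spanned⇒+s≡1+[y-x] I' I'-spanned c' c'-YES a≤b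

    above-wL : ∀ v → a + + dL v ≤ c' (old v)
    above-wL v = k≤∣i-j∣⇒i+k≤j (proj₁ (spanned⇒window I' I'-spanned c' c'-YES a≤b (old v)))
                               (proj₁ c'-YES wL (old v) λ ())

    below-wR : ∀ v → c' (old v) + + dR v ≤ b
    below-wR v = k≤∣i-j∣⇒i+k≤j (proj₂ (spanned⇒window I' I'-spanned c' c'-YES a≤b (old v)))
                               (proj₁ c'-YES (old v) wR λ ())

    a+l≤ : ∀ v → a + + l ≤ c' (old v)
    a+l≤ v = ≤-trans (+-monoʳ-≤ a (+≤+ (l≤dL v))) (above-wL v)

    ≤b-r : ∀ v → c' (old v) ≤ b - + r
    ≤b-r v = i+k≤j⇒i≤j-k (c' (old v)) (≤-trans (+-monoʳ-≤ (c' (old v)) (+≤+ (r≤dR v))) (below-wR v))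

    restrict-span≡ : b - + r - (a + + l) + + 1 ≡ + s I
    restrict-span≡ = begin
      b - + r - (a + + l) + + 1      ≡⟨ regroup a b (+ l) (+ r) ⟩
      + 1 + (b - a) - + l - + r      ≡⟨ cong (λ t → t - + l - + r) +L≡1+b-a ⟨
      + l + + s I + + r - + l - + r  ≡⟨ cancel (+ l) (+ s I) (+ r) ⟩
      + s I                          ∎
      where
      open ≡-Reasoning
      regroup : ∀ a b l r → b - r - (a + l) + + 1 ≡ + 1 + (b - a) - l - r
      regroup = solve-∀
      cancel : ∀ l s r → l + s + r - l - r ≡ s
      cancel = solve-∀

    restrict-YES : YES I (c' ∘ old)
    restrict-YES = (λ x y x≢y → proj₁ c'-YES (old x) (old y) (x≢y ∘ old-injective)) ,
                   bounded⇒SpanAtMost a+l≤ ≤b-r (≤-reflexive restrict-span≡)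

    b≡a+l+w+r : b ≡ a + + (l +ℕ w +ℕ r)
    b≡a+l+w+r = 1+k≡1+[j-i]⇒j≡i+k (trans (cong +_ 1+K≡L) +L≡1+b-a)
      where
      1+K≡L : ℕ.suc (l +ℕ w +ℕ r) ≡ l +ℕ s I +ℕ r
      1+K≡L = trans (cong (_+ℕ r) (sym (ℕ.+-suc l w)))
                    (cong (λ t → l +ℕ t +ℕ r) (1+w≡s spanned (c' ∘ old) restrict-YES))

    restrict-vL : c' (old vL) ≡ a + + l
    restrict-vL = ≤-antisym (begin
      c' (old vL)                      ≤⟨ i+k≤j⇒i≤j-k (c' (old vL)) (below-wR vL) ⟩
      b - + dR vL                      ≡⟨ cong₂ (λ t u → t - + u) b≡a+l+w+r dR-vL ⟩
      a + + (l +ℕ w +ℕ r) - + (r +ℕ w) ≡⟨ drop-wr a (+ l) (+ w) (+ r) ⟩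
      a + + l                          ∎) (a+l≤ vL)
      where
      open ≤-Reasoning
      drop-wr : ∀ a l w r → a + (l + w + r) - (r + w) ≡ a + l
      drop-wr = solve-∀

    restrict-vR : c' (old vR) ≡ b - + r
    restrict-vR = ≤-antisym (≤b-r vR) (begin
      b - + r                      ≡⟨ cong (_- + r) b≡a+l+w+r ⟩
      a + + (l +ℕ w +ℕ r) - + r    ≡⟨ drop-r a (+ l) (+ w) (+ r) ⟩
      a + + (l +ℕ w)               ≡⟨ cong (λ t → a + + t) dL-vR ⟨
      a + + dL vR                  ≤⟨ above-wL vR ⟩
      c' (old vR)                  ∎)
      where
      open ≤-Reasoning
      drop-r : ∀ a l w r → a + (l + w + r) - r ≡ a + (l + w)
      drop-r = solve-∀

lemma6 : ∀ {n : ℕ} (I : Instance (Fin n)) (vL vR : Fin n) → Spanned I vL vR →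
    (l r : ℕ) →
    Σ (Instance (Ext (Fin n))) λ I' →
      (s I' ≡ l +ℕ s I +ℕ r)
      × Spanned I' wL wR
      × (∀ (c : Coloring (Fin n)) → YES I c →
           Σ (Coloring (Ext (Fin n))) λ c' → YES I' c' × (∀ v → c' (old v) ≡ c v))
      × (∀ (c' : Coloring (Ext (Fin n))) → YES I' c' → c' wL ≤ c' wR →
           YES I (c' ∘ old)
           × (c' (old vL) ≡ c' wL + + l)
           × (c' (old vR) ≡ c' wR - + r))
lemma6 I vL vR spanned l r =
  I' , refl , I'-spanned , extension spanned ,
  λ c' c'-YES a≤b → restrict-YES spanned c' c'-YES a≤b ,
                    restrict-vL spanned c' c'-YES a≤b ,
                    restrict-vR spanned c' c'-YES a≤b
  where open Extension _≟ᶠ_ I vL vR l r
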